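{- Let $(C_q,\sigma)$ be a signed cycle on $q$ vertices. Then $r(C_q,\sigma)+2\alpha(C_q)=2q-2c(C_q)$ if and only if either $q\equiv 0\pmod 4$ and $\sigma(C_q)=+$, or $q\equiv 2\pmod 4$ and $\sigma(C_q)=-$.
   Context: A signed graph $(G,\sigma)$ is a simple graph $G$ with $\sigma:E(G)\to\{+,-\}$; $A(G,\sigma)$ has $(i,j)$-entry $\sigma(v_iv_j)$ if $v_iv_j\in E(G)$, else $0$; $r(G,\sigma)$ is its rank. $\alpha$ is the independence number and $c(G)=|E(G)|-|V(G)|+\omega(G)$ the cyclomatic number (so $c(C_q)=1$). The sign of a cycle is $\sigma(C)=\prod_{e\in C}\sigma(e)$. -}

module Defs where

open import Data.Nat using (ℕ; zero; suc; _≡ᵇ_; _≤_)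
open import Data.Bool using (Bool; true; false; if_then_else_; _∨_; _∧_)
open import Data.Fin using (Fin; toℕ)
import Data.Fin as F
open import Data.Fin.Subset using (Subset; _∈_; ∣_∣)
open import Data.Rational using (ℚ; 0ℚ; 1ℚ; _+_; _*_; -_)
open import Relation.Binary.PropositionalEquality using (_≡_)
open import Relation.Nullary using (¬_)
open import Data.Product using (Σ; _×_)
open import Function.Definitions using (Injective)

data Sign : Set where
  plus minus : Sign

_·ₛ_ : Sign → Sign → Sign
plus  ·ₛ s = s
minus ·ₛ plus = minus
minus ·ₛ minus = plus

signℚ : Sign → ℚ
signℚ plus  = 1ℚ
signℚ minus = - 1ℚ

Σℚ : ∀ {n} → (Fin n → ℚ) → ℚ
Σℚ {zero}  f = 0ℚ
Σℚ {suc n} f = f F.zero + Σℚ (λ i → f (F.suc i))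

Πₛ : ∀ {n} → (Fin n → Sign) → Sign
Πₛ {zero}  f = plus
Πₛ {suc n} f = f F.zero ·ₛ Πₛ (λ i → f (F.suc i))

isSucc : (q : ℕ) → Fin q → Fin q → Bool
isSucc q i j = (suc (toℕ i) ≡ᵇ toℕ j) ∨ ((suc (toℕ i) ≡ᵇ q) ∧ (toℕ j ≡ᵇ 0))

CycleAdj : (q : ℕ) → Fin q → Fin q → Set
CycleAdj q i j = (isSucc q i j ∨ isSucc q j i) ≡ true

-- A signature of C_q: σ i is the sign of the edge e_i = {i, i+1 mod q}.
Signature : ℕ → Set
Signature q = Fin q → Sign

cycleSign : ∀ {q} → Signature q → Sign
cycleSign σ = Πₛ σ

adjMatrix : (q : ℕ) → Signature q → Fin q → Fin q → ℚ
adjMatrix q σ i j =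
  if isSucc q i j then signℚ (σ i)
  else if isSucc q j i then signℚ (σ j)
  else 0ℚ

LinIndep : ∀ {k n} → (Fin k → Fin n → ℚ) → Set
LinIndep {k} {n} v =
  (c : Fin k → ℚ) → (∀ j → Σℚ (λ i → c i * v i j) ≡ 0ℚ) → ∀ i → c i ≡ 0ℚ

IsRank : ∀ {m n} → (Fin m → Fin n → ℚ) → ℕ → Set
IsRank {m} {n} A r =
  Σ (Fin r → Fin m) (λ f → Injective _≡_ _≡_ f × LinIndep (λ i → A (f i)))
  × ((g : Fin (suc r) → Fin m) → Injective _≡_ _≡_ g → ¬ LinIndep (λ i → A (g i)))

IsIndependent : ∀ {n} → (Fin n → Fin n → Set) → Subset n → Set
IsIndependent adj S = ∀ i j → i ∈ S → j ∈ S → ¬ adj i j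

IsIndependenceNumber : ∀ {n} → (Fin n → Fin n → Set) → ℕ → Set
IsIndependenceNumber adj a =
  Σ _ (λ S → IsIndependent adj S × ∣ S ∣ ≡ a)
  × (∀ S → IsIndependent adj S → ∣ S ∣ ≤ a)

-- cyclomatic number of C_q: |E| - |V| + ω = q - q + 1 = 1
cyclomaticCycle : ℕ → ℕ
cyclomaticCycle q = 1

module Submission where

-- As c(C_q) = 1 the identity reads r + 2α = 2q − 2, and we compute both invariants.
-- α(C_q) = ⌊q/2⌋: independent sets are sets of non-consecutive positions not containing both
-- 0 and q − 1, counted along the path; the alternating set attains the bound.
-- r = q − 2 if q = 2m and σ(C_q) = (−1)^m, and r = q otherwise: multiplying a left kernel vector
-- by the signs of the walks 0 → ⋯ → k ("switching") turns the kernel equations into the recurrence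
-- f(k + 2) = −f(k), and going once around the cycle twists f by σ(C_q).  Such sequences vanish
-- unless the twist is (−1)^m with q = 2m; then the pulses 1,0,−1,0,… and 0,1,0,−1,… give kernel
-- vectors defeating any q − 1 rows, while the first q − 2 rows stay independent.

module Signs where

  open import Defs
  open import Data.Rational using (ℚ; 0ℚ; 1ℚ; ½; _+_; _*_; -_)
  open import Data.Rational.Properties using (*-assoc; *-comm; *-identityˡ; *-identityʳ; *-zeroˡ; +-inverseʳ; neg-distribˡ-*)
  open import Data.Rational.Solver using (module +-*-Solver)
  open +-*-Solver using (solve; _:=_; _:+_; _:*_; con)
  open import Data.Empty using (⊥-elim)
  open import Relation.Binary.PropositionalEquality

  ·ₛ-assoc : ∀ s t u → (s ·ₛ t) ·ₛ u ≡ s ·ₛ (t ·ₛ u)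
  ·ₛ-assoc plus  t     u     = refl
  ·ₛ-assoc minus plus  u     = refl
  ·ₛ-assoc minus minus plus  = refl
  ·ₛ-assoc minus minus minus = refl

  ·ₛ-comm : ∀ s t → s ·ₛ t ≡ t ·ₛ s
  ·ₛ-comm plus  plus  = refl
  ·ₛ-comm plus  minus = refl
  ·ₛ-comm minus plus  = refl
  ·ₛ-comm minus minus = refl

  signℚ-· : ∀ s t → signℚ (s ·ₛ t) ≡ signℚ s * signℚ t
  signℚ-· plus  plus  = refl
  signℚ-· plus  minus = refl
  signℚ-· minus plus  = refl
  signℚ-· minus minus = refl

  signℚ-square : ∀ s → signℚ s * signℚ s ≡ 1ℚ
  signℚ-square plus  = refl
  signℚ-square minus = refl

  *-sign-sign : ∀ x s → x * signℚ s * signℚ s ≡ x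
  *-sign-sign x s = trans (*-assoc x _ _) (trans (cong (x *_) (signℚ-square s)) (*-identityʳ x))

  sign-*-zero : ∀ s x → signℚ s * x ≡ 0ℚ → x ≡ 0ℚ
  sign-*-zero s x e = begin
    x                        ≡⟨ sym (*-sign-sign x s) ⟩
    x * signℚ s * signℚ s    ≡⟨ cong (_* signℚ s) (*-comm x (signℚ s)) ⟩
    signℚ s * x * signℚ s    ≡⟨ cong (_* signℚ s) e ⟩
    0ℚ * signℚ s             ≡⟨ *-zeroˡ (signℚ s) ⟩
    0ℚ                       ∎
    where open ≡-Reasoning

  x≡-x⇒x≡0 : ∀ x → x ≡ - x → x ≡ 0ℚ
  x≡-x⇒x≡0 x e = begin
    x                 ≡⟨ solve 1 (λ x → x := (x :+ x) :* con ½) refl x ⟩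
    (x + x) * ½       ≡⟨ cong (λ t → (x + t) * ½) e ⟩
    (x + - x) * ½     ≡⟨ cong (_* ½) (+-inverseʳ x) ⟩
    0ℚ * ½            ≡⟨ *-zeroˡ ½ ⟩
    0ℚ                ∎
    where open ≡-Reasoning

  minus-* : ∀ x → signℚ minus * x ≡ - x
  minus-* x = trans (sym (neg-distribˡ-* 1ℚ x)) (cong -_ (*-identityˡ x))

  sign-separates : ∀ s t x → s ≢ t → signℚ s * x ≡ signℚ t * x → x ≡ 0ℚ
  sign-separates plus  plus  x s≢t _ = ⊥-elim (s≢t refl)
  sign-separates minus minus x s≢t _ = ⊥-elim (s≢t refl)
  sign-separates plus  minus x _ e = x≡-x⇒x≡0 x (trans (sym (*-identityˡ x)) (trans e (minus-* x)))
  sign-separates minus plus  x _ e = x≡-x⇒x≡0 x (trans (sym (*-identityˡ x)) (trans (sym e) (minus-* x)))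

-- Sums over Fin, left kernel vectors, and the rank of a rational matrix: a family of rows is
-- independent iff no nonzero left kernel vector is supported on it.
module RowDependence where

  open import Defs
  open import Data.Nat using (ℕ; zero; suc; _≤_; _<_)
  import Data.Nat.Properties as ℕ
  open import Data.Fin using (Fin; inject≤; punchOut)
  import Data.Fin as F
  open import Data.Fin.Properties
    using (inject≤-injective; injective⇒≤; punchOut-injective; punchInᵢ≢i; any?; all?; ¬∀⟶∃¬)
    renaming (_≟_ to _≟ᶠ_)
  open import Data.Vec.Functional using (removeAt)
  open import Data.Rational using (ℚ; 0ℚ; _+_; _*_)
  open import Data.Rational.Properties using (+-*-commutativeRing; +-identityʳ; *-zeroˡ)
  open import Algebra.Bundles using (CommutativeRing)
  open import Algebra.Properties.Semiring.Sum (CommutativeRing.semiring +-*-commutativeRing)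
    using (sum; sum-cong-≗; sum-remove; ∑-comm; ∑-distrib-+; *-distribʳ-sum; sum-replicate-zero)
  open import Data.Bool using (if_then_else_)
  open import Data.Product using (Σ; _,_; proj₁; proj₂)
  open import Data.Sum using (inj₁; inj₂)
  open import Data.Empty using (⊥-elim)
  open import Function.Definitions using (Injective)
  open import Relation.Nullary using (¬_; yes; no; does)
  open import Relation.Nullary.Decidable using (dec-true; dec-false)
  open import Relation.Binary.PropositionalEquality

  Σℚ≡sum : ∀ {n} (f : Fin n → ℚ) → Σℚ f ≡ sum f
  Σℚ≡sum {zero}  f = refl
  Σℚ≡sum {suc n} f = cong (f F.zero +_) (Σℚ≡sum (λ i → f (F.suc i)))

  Σℚ-cong : ∀ {n} {f g : Fin n → ℚ} → (∀ i → f i ≡ g i) → Σℚ f ≡ Σℚ g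
  Σℚ-cong {f = f} {g} f≗g = trans (Σℚ≡sum f) (trans (sum-cong-≗ {x = f} {y = g} f≗g) (sym (Σℚ≡sum g)))

  Σℚ-single : ∀ {n} (f : Fin n → ℚ) (a : Fin n) → (∀ i → i ≢ a → f i ≡ 0ℚ) → Σℚ f ≡ f a
  Σℚ-single {suc n} f a off-a = begin
    Σℚ f                        ≡⟨ Σℚ≡sum f ⟩
    sum f                       ≡⟨ sum-remove {i = a} f ⟩
    f a + sum (removeAt f a)
      ≡⟨ cong (f a +_) (sum-cong-≗ {n} {x = removeAt f a} {y = λ _ → 0ℚ} (λ k → off-a _ (punchInᵢ≢i a k))) ⟩
    f a + sum {n} (λ _ → 0ℚ)    ≡⟨ cong (f a +_) (sum-replicate-zero n) ⟩
    f a + 0ℚ                    ≡⟨ +-identityʳ (f a) ⟩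
    f a                         ∎
    where open ≡-Reasoning

  Σℚ-*ʳ : ∀ {n} (f : Fin n → ℚ) x → Σℚ f * x ≡ Σℚ (λ i → f i * x)
  Σℚ-*ʳ f x = begin
    Σℚ f * x                 ≡⟨ cong (_* x) (Σℚ≡sum f) ⟩
    sum f * x                ≡⟨ *-distribʳ-sum x f ⟩
    sum (λ i → f i * x)      ≡⟨ sym (Σℚ≡sum (λ i → f i * x)) ⟩
    Σℚ (λ i → f i * x)       ∎
    where open ≡-Reasoning

  Σℚ-+ : ∀ {n} (f g : Fin n → ℚ) → Σℚ (λ i → f i + g i) ≡ Σℚ f + Σℚ g
  Σℚ-+ f g = begin
    Σℚ (λ i → f i + g i)      ≡⟨ Σℚ≡sum (λ i → f i + g i) ⟩
    sum (λ i → f i + g i)     ≡⟨ ∑-distrib-+ f g ⟩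
    sum f + sum g             ≡⟨ sym (cong₂ _+_ (Σℚ≡sum f) (Σℚ≡sum g)) ⟩
    Σℚ f + Σℚ g               ∎
    where open ≡-Reasoning

  Σℚ-comm : ∀ {m n} (f : Fin m → Fin n → ℚ) →
    Σℚ (λ i → Σℚ (λ j → f i j)) ≡ Σℚ (λ j → Σℚ (λ i → f i j))
  Σℚ-comm f = begin
    Σℚ (λ i → Σℚ (f i))             ≡⟨ Σℚ≡sum (λ i → Σℚ (f i)) ⟩
    sum (λ i → Σℚ (f i))
      ≡⟨ sum-cong-≗ {x = λ i → Σℚ (f i)} {y = λ i → sum (f i)} (λ i → Σℚ≡sum (f i)) ⟩
    sum (λ i → sum (f i))           ≡⟨ ∑-comm f ⟩
    sum (λ j → sum (λ i → f i j))
      ≡⟨ sum-cong-≗ {x = λ j → sum (λ i → f i j)} {y = λ j → Σℚ (λ i → f i j)} (λ j → sym (Σℚ≡sum (λ i → f i j))) ⟩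
    sum (λ j → Σℚ (λ i → f i j))    ≡⟨ sym (Σℚ≡sum (λ j → Σℚ (λ i → f i j))) ⟩
    Σℚ (λ j → Σℚ (λ i → f i j))     ∎
    where open ≡-Reasoning

  LeftKernel : ∀ {m n} → (Fin m → Fin n → ℚ) → (Fin m → ℚ) → Set
  LeftKernel A z = ∀ j → Σℚ (λ l → z l * A l j) ≡ 0ℚ

  Outside : ∀ {k m} → (Fin k → Fin m) → Fin m → Set
  Outside g l = ∀ i → g i ≢ l

  place : ∀ {N} → Fin N → Fin N → ℚ → ℚ
  place a l x = if does (a ≟ᶠ l) then x else 0ℚ

  place-here : ∀ {N} (a : Fin N) x → place a a x ≡ x
  place-here a x rewrite dec-true (a ≟ᶠ a) refl = refl

  place-elsewhere : ∀ {N} (a l : Fin N) x → a ≢ l → place a l x ≡ 0ℚ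
  place-elsewhere a l x a≢l rewrite dec-false (a ≟ᶠ l) a≢l = refl

  push : ∀ {k m} → (Fin k → Fin m) → (Fin k → ℚ) → Fin m → ℚ
  push g c l = Σℚ (λ i → place (g i) l (c i))

  push-Σ : ∀ {k m} (g : Fin k → Fin m) (c : Fin k → ℚ) (w : Fin m → ℚ) →
    Σℚ (λ l → push g c l * w l) ≡ Σℚ (λ i → c i * w (g i))
  push-Σ g c w = begin
    Σℚ (λ l → push g c l * w l)                        ≡⟨ Σℚ-cong (λ l → Σℚ-*ʳ (λ i → place (g i) l (c i)) (w l)) ⟩
    Σℚ (λ l → Σℚ (λ i → place (g i) l (c i) * w l))    ≡⟨ sym (Σℚ-comm (λ i l → place (g i) l (c i) * w l)) ⟩
    Σℚ (λ i → Σℚ (λ l → place (g i) l (c i) * w l))    ≡⟨ Σℚ-cong (λ i → Σℚ-single _ (g i) (elsewhere i)) ⟩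
    Σℚ (λ i → place (g i) (g i) (c i) * w (g i))       ≡⟨ Σℚ-cong (λ i → cong (_* w (g i)) (place-here (g i) (c i))) ⟩
    Σℚ (λ i → c i * w (g i))                           ∎
    where
    open ≡-Reasoning
    elsewhere : ∀ i l → l ≢ g i → place (g i) l (c i) * w l ≡ 0ℚ
    elsewhere i l l≢gi = trans (cong (_* w l) (place-elsewhere (g i) l (c i) (λ e → l≢gi (sym e))))
                               (*-zeroˡ (w l))

  push-image : ∀ {k m} (g : Fin k → Fin m) → Injective _≡_ _≡_ g →
    (c : Fin k → ℚ) (i : Fin k) → push g c (g i) ≡ c i
  push-image g g-inj c i =
    trans (Σℚ-single _ i (λ i′ i′≢i → place-elsewhere (g i′) (g i) (c i′) (λ e → i′≢i (g-inj e))))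
          (place-here (g i) (c i))

  push-outside : ∀ {k m} (g : Fin k → Fin m) (c : Fin k → ℚ) (l : Fin m) →
    Outside g l → push g c l ≡ 0ℚ
  push-outside {k} g c l out =
    trans (Σℚ-cong (λ i → place-elsewhere (g i) l (c i) (out i)))
          (trans (Σℚ≡sum {k} (λ _ → 0ℚ)) (sum-replicate-zero k))

  push-kernel : ∀ {k m n} (A : Fin m → Fin n → ℚ) (g : Fin k → Fin m) (c : Fin k → ℚ) →
    LeftKernel (λ i → A (g i)) c → LeftKernel A (push g c)
  push-kernel A g c K j = trans (push-Σ g c (λ l → A l j)) (K j)

  independent-rows : ∀ {k m n} (A : Fin m → Fin n → ℚ) (g : Fin k → Fin m) → Injective _≡_ _≡_ g →
    (∀ z → LeftKernel A z → (∀ l → Outside g l → z l ≡ 0ℚ) → ∀ l → z l ≡ 0ℚ) →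
    LinIndep (λ i → A (g i))
  independent-rows A g g-inj only-zero c K i =
    trans (sym (push-image g g-inj c i))
          (only-zero (push g c) (push-kernel A g c K) (push-outside g c) (g i))

  dependent-rows : ∀ {k m n} (A : Fin m → Fin n → ℚ) (g : Fin k → Fin m) → Injective _≡_ _≡_ g →
    (z : Fin m → ℚ) → LeftKernel A z → (∀ l → Outside g l → z l ≡ 0ℚ) →
    (w : Fin m) → z w ≢ 0ℚ → ¬ LinIndep (λ i → A (g i))
  dependent-rows A g g-inj z K supp w zw≢0 indep with any? (λ i → g i ≟ᶠ w)
  ... | yes (i , gi≡w) = zw≢0 (trans (cong z (sym gi≡w)) (indep (λ i → z (g i)) K′ i))
    where
    push-restrict : ∀ l → push g (λ i → z (g i)) l ≡ z l
    push-restrict l with any? (λ i → g i ≟ᶠ l)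
    ... | yes (i , refl) = push-image g g-inj _ i
    ... | no  l-out      = trans (push-outside g _ l out) (sym (supp l out))
      where out = λ i e → l-out (i , e)
    K′ : LeftKernel (λ i → A (g i)) (λ i → z (g i))
    K′ j = trans (sym (push-Σ g _ (λ l → A l j)))
                 (trans (Σℚ-cong (λ l → cong (_* A l j) (push-restrict l))) (K j))
  ... | no w-out = zw≢0 (supp w (λ i e → w-out (i , e)))

  independent-subfamily : ∀ {k m n} (A : Fin m → Fin n → ℚ) (g : Fin k → Fin m) →
    Injective _≡_ _≡_ g → LinIndep A → LinIndep (λ i → A (g i))
  independent-subfamily A g g-inj indep = independent-rows A g g-inj (λ z K _ → indep z K)

  rank-lower : ∀ {k m n r} (A : Fin m → Fin n → ℚ) → IsRank A r →
    (g : Fin k → Fin m) → Injective _≡_ _≡_ g → LinIndep (λ i → A (g i)) → k ≤ r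
  rank-lower {k} {r = r} A (_ , maximal) g g-inj indep with ℕ.≤-<-connex k r
  ... | inj₁ k≤r = k≤r
  ... | inj₂ r<k = ⊥-elim (maximal (λ i → g (h i)) (λ e → h-inj (g-inj e))
                                   (independent-subfamily (λ i → A (g i)) h h-inj indep))
    where
    h : Fin (suc r) → Fin k
    h i = inject≤ i r<k
    h-inj : Injective _≡_ _≡_ h
    h-inj {x} {y} = inject≤-injective r<k r<k x y

  rank-upper : ∀ {k m n r} (A : Fin m → Fin n → ℚ) → IsRank A r →
    ((g : Fin k → Fin m) → Injective _≡_ _≡_ g → ¬ LinIndep (λ i → A (g i))) → r < k
  rank-upper {k} {r = r} A ((f , f-inj , indep) , _) dependent with ℕ.<-≤-connex r k
  ... | inj₁ r<k = r<k
  ... | inj₂ k≤r = ⊥-elim (dependent (λ i → f (h i)) (λ e → h-inj (f-inj e))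
                                     (independent-subfamily (λ i → A (f i)) h h-inj indep))
    where
    h : Fin k → Fin r
    h i = inject≤ i k≤r
    h-inj : Injective _≡_ _≡_ h
    h-inj {x} {y} = inject≤-injective k≤r k≤r x y

  rank-≤-rows : ∀ {m n r} (A : Fin m → Fin n → ℚ) → IsRank A r → r ≤ m
  rank-≤-rows A ((f , f-inj , _) , _) = injective⇒≤ f-inj

  full-rank : ∀ {m n r} (A : Fin m → Fin n → ℚ) → IsRank A r →
    (∀ z → LeftKernel A z → ∀ l → z l ≡ 0ℚ) → r ≡ m
  full-rank A R trivial = ℕ.≤-antisym (rank-≤-rows A R) (rank-lower A R (λ l → l) (λ e → e) trivial)

  missing-point : ∀ {p} (g : Fin p → Fin (suc p)) → Injective _≡_ _≡_ g → Σ (Fin (suc p)) (Outside g)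
  missing-point {p} g g-inj with all? (λ l → any? (λ i → g i ≟ᶠ l))
  ... | yes covered = ⊥-elim (ℕ.n≮n p (injective⇒≤ {f = preimage} preimage-inj))
    where
    preimage : Fin (suc p) → Fin p
    preimage l = proj₁ (covered l)
    preimage-inj : Injective _≡_ _≡_ preimage
    preimage-inj {x} {y} e = trans (sym (proj₂ (covered x))) (trans (cong g e) (proj₂ (covered y)))
  ... | no not-covered with ¬∀⟶∃¬ (suc p) _ (λ l → any? (λ i → g i ≟ᶠ l)) not-covered
  ...   | l , l-out = l , (λ i e → l-out (i , e))

  -- ... and only one: two missed points would give an injection of Fin p into Fin (p − 1).
  missing-unique : ∀ {p} (g : Fin p → Fin (suc p)) → Injective _≡_ _≡_ g →
    ∀ a b → Outside g a → Outside g b → a ≡ b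
  missing-unique {zero}  g g-inj F.zero F.zero a-out b-out = refl
  missing-unique {suc p} g g-inj a b a-out b-out with a ≟ᶠ b
  ... | yes a≡b = a≡b
  ... | no  a≢b = ⊥-elim (ℕ.n≮n p (injective⇒≤ {f = h₂} h₂-inj))
    where
    h₁ : Fin (suc p) → Fin (suc p)
    h₁ i = punchOut {i = a} {j = g i} (λ e → a-out i (sym e))
    h₁-inj : Injective _≡_ _≡_ h₁
    h₁-inj {x} {y} e = g-inj (punchOut-injective (λ e → a-out x (sym e)) (λ e → a-out y (sym e)) e)
    b′ : Fin (suc p)
    b′ = punchOut a≢b
    b′-out : ∀ i → b′ ≢ h₁ i
    b′-out i e = b-out i (sym (punchOut-injective a≢b (λ e → a-out i (sym e)) e))
    h₂ : Fin (suc p) → Fin p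
    h₂ i = punchOut (b′-out i)
    h₂-inj : Injective _≡_ _≡_ h₂
    h₂-inj {x} {y} e = h₁-inj (punchOut-injective (b′-out x) (b′-out y) e)

module CycleAdjacency where

  open import Defs
  open RowDependence using (Σℚ-cong; Σℚ-+; Σℚ-single)
  open import Data.Nat using (ℕ; suc; _≤_; _<_; s≤s; z≤n)
  import Data.Nat.Properties as ℕ
  open import Data.Bool using (true; false; if_then_else_)
  open import Data.Bool.Properties using (T-≡; T-∨; T-∧)
  open import Data.Fin using (Fin; toℕ)
  open import Data.Fin.Properties using (toℕ-injective; toℕ<n)
  open import Data.Rational using (ℚ; 0ℚ; _+_; _*_)
  open import Data.Rational.Properties using (+-identityˡ; +-identityʳ; *-zeroʳ; *-distribˡ-+)
  open import Data.Product using (_×_; _,_; proj₁; proj₂)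
  open import Data.Sum using (_⊎_; inj₁; inj₂; map)
  open import Data.Empty using (⊥; ⊥-elim)
  open import Function.Bundles using (Equivalence)
  open import Relation.Binary.PropositionalEquality

  Succ : ℕ → ℕ → ℕ → Set
  Succ q a b = (suc a ≡ b) ⊎ (suc a ≡ q × b ≡ 0)

  isSucc-sound : ∀ q (i j : Fin q) → isSucc q i j ≡ true → Succ q (toℕ i) (toℕ j)
  isSucc-sound q i j e = map (ℕ.≡ᵇ⇒≡ _ _) both (Equivalence.to T-∨ (Equivalence.from T-≡ e))
    where
    both = λ t → ℕ.≡ᵇ⇒≡ _ _ (proj₁ (Equivalence.to T-∧ t)) , ℕ.≡ᵇ⇒≡ _ _ (proj₂ (Equivalence.to T-∧ t))

  isSucc-complete : ∀ q (i j : Fin q) → Succ q (toℕ i) (toℕ j) → isSucc q i j ≡ true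
  isSucc-complete q i j s =
    Equivalence.to T-≡ (Equivalence.from T-∨
      (map (ℕ.≡⇒≡ᵇ _ _) (λ (e₁ , e₂) → Equivalence.from T-∧ (ℕ.≡⇒≡ᵇ _ _ e₁ , ℕ.≡⇒≡ᵇ _ _ e₂)) s))

  successor-unique : ∀ q (i j j′ : Fin q) → isSucc q i j ≡ true → isSucc q i j′ ≡ true → j ≡ j′
  successor-unique q i j j′ e e′ = toℕ-injective (same (isSucc-sound q i j e) (isSucc-sound q i j′ e′))
    where
    same : Succ q (toℕ i) (toℕ j) → Succ q (toℕ i) (toℕ j′) → toℕ j ≡ toℕ j′
    same (inj₁ s)       (inj₁ s′)       = trans (sym s) s′
    same (inj₁ s)       (inj₂ (s′ , _)) = ⊥-elim (ℕ.<-irrefl (trans (sym s) s′) (toℕ<n j))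
    same (inj₂ (s , _)) (inj₁ s′)       = ⊥-elim (ℕ.<-irrefl (trans (sym s′) s) (toℕ<n j′))
    same (inj₂ (_ , z)) (inj₂ (_ , z′)) = trans z (sym z′)

  predecessor-unique : ∀ q (i i′ j : Fin q) → isSucc q i j ≡ true → isSucc q i′ j ≡ true → i ≡ i′
  predecessor-unique q i i′ j e e′ = toℕ-injective (same (isSucc-sound q i j e) (isSucc-sound q i′ j e′))
    where
    same : Succ q (toℕ i) (toℕ j) → Succ q (toℕ i′) (toℕ j) → toℕ i ≡ toℕ i′
    same (inj₁ s)       (inj₁ s′)       = ℕ.suc-injective (trans s (sym s′))
    same (inj₁ s)       (inj₂ (_ , z′)) with () ← trans s z′
    same (inj₂ (_ , z)) (inj₁ s′)       with () ← trans s′ z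
    same (inj₂ (s , _)) (inj₂ (s′ , _)) = ℕ.suc-injective (trans s (sym s′))

  successor-asym : ∀ q → 3 ≤ q → (i j : Fin q) → isSucc q i j ≡ true → isSucc q j i ≡ true → ⊥
  successor-asym q 3≤q i j e e′ = two-cycle (isSucc-sound q i j e) (isSucc-sound q j i e′)
    where
    too-short : ∀ {k} → q ≡ suc k → k < 2 → ⊥
    too-short refl k<2 with ℕ.≤-trans 3≤q k<2
    ... | s≤s (s≤s ())
    two-cycle : Succ q (toℕ i) (toℕ j) → Succ q (toℕ j) (toℕ i) → ⊥
    two-cycle (inj₁ s) (inj₁ s′) = ℕ.<-irrefl (sym (trans (cong suc s) s′)) (ℕ.m<n⇒m<1+n (ℕ.n<1+n _))
    two-cycle (inj₁ s) (inj₂ (q≡ , z)) = too-short (sym q≡) (subst (_< 2) (sym (trans (sym s) (cong suc z))) ℕ.≤-refl)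
    two-cycle (inj₂ (q≡ , z)) (inj₁ s′) = too-short (sym q≡) (subst (_< 2) (sym (trans (sym s′) (cong suc z))) ℕ.≤-refl)
    two-cycle (inj₂ (q≡ , z)) (inj₂ (_ , z′)) = too-short (sym q≡) (subst (_< 2) (sym z′) (s≤s z≤n))

  ifSucc : (q : ℕ) → Fin q → Fin q → ℚ → ℚ
  ifSucc q i j x = if isSucc q i j then x else 0ℚ

  adj-split : ∀ q → 3 ≤ q → (σ : Signature q) (i j : Fin q) →
    adjMatrix q σ i j ≡ ifSucc q i j (signℚ (σ i)) + ifSucc q j i (signℚ (σ j))
  adj-split q 3≤q σ i j with isSucc q i j in e | isSucc q j i in e′
  ... | true  | true  = ⊥-elim (successor-asym q 3≤q i j e e′)
  ... | true  | false = sym (+-identityʳ _)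
  ... | false | true  = sym (+-identityˡ _)
  ... | false | false = refl

  column-sum : ∀ q → 3 ≤ q → (σ : Signature q) (c : Fin q → ℚ) (p j s : Fin q) →
    isSucc q p j ≡ true → isSucc q j s ≡ true →
    Σℚ (λ i → c i * adjMatrix q σ i j) ≡ c p * signℚ (σ p) + c s * signℚ (σ j)
  column-sum q 3≤q σ c p j s p→j j→s = begin
    Σℚ (λ i → c i * adjMatrix q σ i j)
      ≡⟨ Σℚ-cong (λ i → trans (cong (c i *_) (adj-split q 3≤q σ i j)) (*-distribˡ-+ (c i) _ _)) ⟩
    Σℚ (λ i → forward i + backward i)
      ≡⟨ Σℚ-+ forward backward ⟩
    Σℚ forward + Σℚ backward
      ≡⟨ cong₂ _+_ (Σℚ-single forward p forward-zero) (Σℚ-single backward s backward-zero) ⟩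
    forward p + backward s
      ≡⟨ cong₂ _+_ (cong (λ b → c p * (if b then signℚ (σ p) else 0ℚ)) p→j)
                   (cong (λ b → c s * (if b then signℚ (σ j) else 0ℚ)) j→s) ⟩
    c p * signℚ (σ p) + c s * signℚ (σ j)
      ∎
    where
    open ≡-Reasoning
    forward backward : Fin q → ℚ
    forward  i = c i * ifSucc q i j (signℚ (σ i))
    backward i = c i * ifSucc q j i (signℚ (σ j))
    forward-zero : ∀ i → i ≢ p → forward i ≡ 0ℚ
    forward-zero i i≢p with isSucc q i j in i→j
    ... | true  = ⊥-elim (i≢p (predecessor-unique q i p j i→j p→j))
    ... | false = *-zeroʳ (c i)
    backward-zero : ∀ i → i ≢ s → backward i ≡ 0ℚ
    backward-zero i i≢s with isSucc q j i in j→i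
    ... | true  = ⊥-elim (i≢s (successor-unique q j i s j→i j→s))
    ... | false = *-zeroʳ (c i)

module IndependenceNumber where

  open import Defs
  open CycleAdjacency using (isSucc-sound; isSucc-complete)
  open import Data.Nat using (ℕ; zero; suc; _≤_; _+_; s≤s; z≤n)
  import Data.Nat.Properties as ℕ
  open import Data.Bool using (true; false; _∨_)
  open import Data.Fin using (toℕ)
  import Data.Fin as F
  open import Data.Fin.Properties using (toℕ-injective)
  open import Data.Fin.Subset using (Subset; _∈_; _∉_; ∣_∣)
  open import Data.Vec using ([]; _∷_; here; there)
  open import Data.Product using (_×_; _,_)
  open import Data.Sum using (inj₁; inj₂)
  open import Data.Empty using (⊥; ⊥-elim)
  open import Relation.Binary.PropositionalEquality

  Sparse : ∀ {n} → Subset n → Set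
  Sparse S = ∀ i j → toℕ j ≡ suc (toℕ i) → i ∈ S → j ∉ S

  LastOut : ∀ {n} → Subset n → Set
  LastOut {n} S = ∀ i → suc (toℕ i) ≡ n → i ∉ S

  sparse-tail : ∀ {n b} {S : Subset n} → Sparse (b ∷ S) → Sparse S
  sparse-tail sp i j j≡ i∈ j∈ = sp (F.suc i) (F.suc j) (cong suc j≡) (there i∈) (there j∈)

  sparse-false∷ : ∀ {n} {S : Subset n} → Sparse S → Sparse (false ∷ S)
  sparse-false∷ sp (F.suc i) (F.suc j) j≡ (there i∈) (there j∈) = sp i j (ℕ.suc-injective j≡) i∈ j∈

  sparse-true∷false∷ : ∀ {n} {S : Subset n} → Sparse S → Sparse (true ∷ false ∷ S)
  sparse-true∷false∷ sp F.zero    (F.suc F.zero) _  _          (there ())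
  sparse-true∷false∷ sp (F.suc i) (F.suc j)      j≡ (there i∈) (there j∈) =
    sparse-false∷ sp i j (ℕ.suc-injective j≡) i∈ j∈

  lastOut-tail : ∀ {n b} {S : Subset n} → LastOut (b ∷ S) → LastOut S
  lastOut-tail lo i i≡ i∈ = lo (F.suc i) (cong suc i≡) (there i∈)

  lastOut-false∷ : ∀ {n} {S : Subset n} → LastOut S → LastOut (false ∷ S)
  lastOut-false∷ {zero}  lo F.zero    _  ()
  lastOut-false∷ {suc n} lo (F.suc i) i≡ (there i∈) = lo i (ℕ.suc-injective i≡) i∈

  lastOut-∷ : ∀ {n b} {S : Subset (suc n)} → LastOut S → LastOut (b ∷ S)
  lastOut-∷ lo (F.suc i) i≡ (there i∈) = lo i (ℕ.suc-injective i≡) i∈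

  ∣true∷false∷∣ : ∀ {n} (S : Subset n) →
    ∣ true ∷ false ∷ S ∣ + ∣ true ∷ false ∷ S ∣ ≡ suc (suc (∣ S ∣ + ∣ S ∣))
  ∣true∷false∷∣ S = cong suc (ℕ.+-suc ∣ S ∣ ∣ S ∣)

  sparse-bound : ∀ {n} (S : Subset n) → Sparse S → ∣ S ∣ + ∣ S ∣ ≤ suc n
  sparse-bound []                 sp = z≤n
  sparse-bound (false ∷ S)        sp = ℕ.m≤n⇒m≤1+n (sparse-bound S (sparse-tail sp))
  sparse-bound (true ∷ [])        sp = ℕ.≤-refl
  sparse-bound (true ∷ true ∷ S)  sp = ⊥-elim (sp F.zero (F.suc F.zero) refl here (there here))
  sparse-bound (true ∷ false ∷ S) sp rewrite ∣true∷false∷∣ S =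
    s≤s (s≤s (sparse-bound S (sparse-tail (sparse-tail sp))))

  sparse-lastOut-bound : ∀ {n} (S : Subset n) → Sparse S → LastOut S → ∣ S ∣ + ∣ S ∣ ≤ n
  sparse-lastOut-bound []                 sp lo = z≤n
  sparse-lastOut-bound (false ∷ S)        sp lo =
    ℕ.m≤n⇒m≤1+n (sparse-lastOut-bound S (sparse-tail sp) (lastOut-tail lo))
  sparse-lastOut-bound (true ∷ [])        sp lo = ⊥-elim (lo F.zero refl here)
  sparse-lastOut-bound (true ∷ true ∷ S)  sp lo = ⊥-elim (sp F.zero (F.suc F.zero) refl here (there here))
  sparse-lastOut-bound (true ∷ false ∷ S) sp lo rewrite ∣true∷false∷∣ S =
    s≤s (s≤s (sparse-lastOut-bound S (sparse-tail (sparse-tail sp)) (lastOut-tail (lastOut-tail lo))))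

  independent⇒sparse : ∀ {q} (S : Subset q) → IsIndependent (CycleAdj q) S → Sparse S
  independent⇒sparse {q} S ind i j j≡ i∈ j∈ =
    ind i j i∈ j∈ (cong (_∨ isSucc q j i) (isSucc-complete q i j (inj₁ (sym j≡))))

  independent⇒wrap : ∀ {p} (S : Subset (suc p)) → IsIndependent (CycleAdj (suc p)) S → F.zero ∈ S → LastOut S
  independent⇒wrap {p} S ind 0∈ i i≡ i∈ =
    ind i F.zero i∈ 0∈ (cong (_∨ isSucc (suc p) F.zero i) (isSucc-complete (suc p) i F.zero (inj₂ (i≡ , refl))))

  sparse-no-succ : ∀ {p} (S : Subset (suc p)) → Sparse S → (F.zero ∈ S → LastOut S) →
    ∀ i j → i ∈ S → j ∈ S → isSucc (suc p) i j ≡ true → ⊥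
  sparse-no-succ {p} S sp wrap i j i∈ j∈ i→j with isSucc-sound (suc p) i j i→j
  ... | inj₁ s       = sp i j (sym s) i∈ j∈
  ... | inj₂ (s , z) = wrap (subst (_∈ S) (toℕ-injective z) j∈) i s i∈

  sparse⇒independent : ∀ {p} (S : Subset (suc p)) → Sparse S → (F.zero ∈ S → LastOut S) →
    IsIndependent (CycleAdj (suc p)) S
  sparse⇒independent {p} S sp wrap i j i∈ j∈ adj with isSucc (suc p) i j in i→j
  ... | true  = sparse-no-succ S sp wrap i j i∈ j∈ i→j
  ... | false = sparse-no-succ S sp wrap j i j∈ i∈ adj

  independent-bound : ∀ {p} (S : Subset (suc p)) → IsIndependent (CycleAdj (suc p)) S → ∣ S ∣ + ∣ S ∣ ≤ suc p
  independent-bound (false ∷ S) ind = sparse-bound S (sparse-tail (independent⇒sparse _ ind))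
  independent-bound (true ∷ []) ind = ⊥-elim (independent⇒wrap _ ind here F.zero refl here)
  independent-bound (true ∷ true ∷ S) ind =
    ⊥-elim (independent⇒sparse _ ind F.zero (F.suc F.zero) refl here (there here))
  independent-bound (true ∷ false ∷ S) ind rewrite ∣true∷false∷∣ S =
    s≤s (s≤s (sparse-lastOut-bound S (sparse-tail (sparse-tail (independent⇒sparse _ ind)))
                                     (lastOut-tail (lastOut-tail (independent⇒wrap _ ind here)))))

  alternating : (n : ℕ) → Subset n
  alternating zero          = []
  alternating (suc zero)    = false ∷ []
  alternating (suc (suc n)) = true ∷ false ∷ alternating n

  alternating-sparse : ∀ n → Sparse (alternating n)
  alternating-sparse zero          = λ ()
  alternating-sparse (suc zero)    = sparse-false∷ (λ ())
  alternating-sparse (suc (suc n)) = sparse-true∷false∷ (alternating-sparse n)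

  alternating-lastOut : ∀ n → LastOut (alternating n)
  alternating-lastOut zero          = λ ()
  alternating-lastOut (suc zero)    = lastOut-false∷ (λ ())
  alternating-lastOut (suc (suc n)) = lastOut-∷ (lastOut-false∷ (alternating-lastOut n))

  alternating-independent : ∀ p → IsIndependent (CycleAdj (suc p)) (alternating (suc p))
  alternating-independent p =
    sparse⇒independent _ (alternating-sparse (suc p)) (λ _ → alternating-lastOut (suc p))

  alternating-size : ∀ n → n ≤ suc (∣ alternating n ∣ + ∣ alternating n ∣)
  alternating-size zero          = z≤n
  alternating-size (suc zero)    = s≤s z≤n
  alternating-size (suc (suc n)) rewrite ∣true∷false∷∣ (alternating n) = s≤s (s≤s (alternating-size n))

  independence-number-bounds : ∀ {p a} → IsIndependenceNumber (CycleAdj (suc p)) a →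
    a + a ≤ suc p × suc p ≤ suc (a + a)
  independence-number-bounds {p} ((S , ind , ∣S∣≡a) , maximum) =
    subst (λ t → t + t ≤ suc p) ∣S∣≡a (independent-bound S ind) ,
    ℕ.≤-trans (alternating-size (suc p)) (s≤s (ℕ.+-mono-≤ alt≤a alt≤a))
    where alt≤a = maximum (alternating (suc p)) (alternating-independent p)

-- Rational sequences with f(k + 2) = −f(k) ("antiperiodic"), possibly picking up a sign after
-- q steps ("twisted"): these are the switched left kernel vectors of A(C_q, σ).
module SignedSequences where

  open import Defs
  open Signs
  open import Data.Nat using (ℕ; zero; suc; NonZero; _%_; _/_)
    renaming (_+_ to _+ℕ_; _*_ to _*ℕ_)
  import Data.Nat.Properties as ℕ
  open import Data.Nat.DivMod using (m≡m%n+[m/n]*n)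
  import Data.Nat.Solver
  module ℕS = Data.Nat.Solver.+-*-Solver
  open import Data.Rational using (ℚ; 0ℚ; 1ℚ; _*_; -_)
  open import Data.Rational.Properties using (*-assoc; *-identityˡ; neg-injective)
  open import Data.Rational.Solver using (module +-*-Solver)
  open +-*-Solver using (solve; _:=_; _:*_)
  open import Data.Sum using (_⊎_; inj₁; inj₂)
  import Data.Sum
  open import Relation.Binary.PropositionalEquality

  k+q+q≡2q+k : ∀ k q → k +ℕ q +ℕ q ≡ 2 *ℕ q +ℕ k
  k+q+q≡2q+k = ℕS.solve 2 (λ k q → k ℕS.:+ q ℕS.:+ q ℕS.:= ℕS.con 2 ℕS.:* q ℕS.:+ k) refl

  r+[q+x]≡r+x+q : ∀ r q x → r +ℕ (q +ℕ x) ≡ r +ℕ x +ℕ q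
  r+[q+x]≡r+x+q = ℕS.solve 3 (λ r q x → r ℕS.:+ (q ℕS.:+ x) ℕS.:= r ℕS.:+ x ℕS.:+ q) refl

  altSign : ℕ → Sign
  altSign zero    = plus
  altSign (suc m) = minus ·ₛ altSign m

  altSign-even : ∀ k → altSign (2 *ℕ k) ≡ plus
  altSign-even zero    = refl
  altSign-even (suc k) =
    trans (cong altSign (ℕ.*-suc 2 k)) (cong (λ s → minus ·ₛ (minus ·ₛ s)) (altSign-even k))

  altSign-odd : ∀ k → altSign (suc (2 *ℕ k)) ≡ minus
  altSign-odd k rewrite altSign-even k = refl

  AntiPeriodic : (ℕ → ℚ) → Set
  AntiPeriodic f = ∀ k → f (suc (suc k)) ≡ - f k

  Twisted : ℕ → Sign → (ℕ → ℚ) → Set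
  Twisted q s f = ∀ k → f (k +ℕ q) ≡ signℚ s * f k

  antiperiodic-shift : ∀ {f} → AntiPeriodic f → ∀ m k → f (2 *ℕ m +ℕ k) ≡ signℚ (altSign m) * f k
  antiperiodic-shift {f} anti zero    k = sym (*-identityˡ (f k))
  antiperiodic-shift {f} anti (suc m) k = begin
    f (2 *ℕ suc m +ℕ k)                            ≡⟨ cong (λ t → f (t +ℕ k)) (ℕ.*-suc 2 m) ⟩
    f (suc (suc (2 *ℕ m +ℕ k)))                    ≡⟨ anti (2 *ℕ m +ℕ k) ⟩
    - f (2 *ℕ m +ℕ k)                              ≡⟨ cong -_ (antiperiodic-shift anti m k) ⟩
    - (signℚ (altSign m) * f k)                    ≡⟨ sym (minus-* _) ⟩
    signℚ minus * (signℚ (altSign m) * f k)        ≡⟨ sym (*-assoc (signℚ minus) (signℚ (altSign m)) (f k)) ⟩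
    signℚ minus * signℚ (altSign m) * f k          ≡⟨ cong (_* f k) (sym (signℚ-· minus (altSign m))) ⟩
    signℚ (minus ·ₛ altSign m) * f k               ∎
    where open ≡-Reasoning

  antiperiodic-vanish : ∀ {f} → AntiPeriodic f → ∀ j → f j ≡ 0ℚ → f (suc j) ≡ 0ℚ → ∀ k → f k ≡ 0ℚ
  antiperiodic-vanish {f} anti zero    f0 f1 = everywhere
    where
    everywhere : ∀ k → f k ≡ 0ℚ
    everywhere zero          = f0
    everywhere (suc zero)    = f1
    everywhere (suc (suc k)) = trans (anti k) (cong -_ (everywhere k))
  antiperiodic-vanish {f} anti (suc j) fj fj+1 =
    antiperiodic-vanish anti j (neg-injective (trans (sym (anti j)) fj+1)) fj

  -- Antiperiodic sequences twisted along an odd period vanish: going around twice gives f = −f.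
  odd-vanish : ∀ {f q s m} → AntiPeriodic f → Twisted q s f → q ≡ suc (2 *ℕ m) → ∀ k → f k ≡ 0ℚ
  odd-vanish {f} {q} {s} {m} anti tw q≡ k = x≡-x⇒x≡0 (f k) (begin
    f k                                    ≡⟨ sym (*-sign-sign (f k) s) ⟩
    f k * signℚ s * signℚ s                ≡⟨ solve 2 (λ x t → x :* t :* t := t :* (t :* x)) refl (f k) (signℚ s) ⟩
    signℚ s * (signℚ s * f k)              ≡⟨ cong (signℚ s *_) (sym (tw k)) ⟩
    signℚ s * f (k +ℕ q)                   ≡⟨ sym (tw (k +ℕ q)) ⟩
    f (k +ℕ q +ℕ q)                        ≡⟨ cong f (k+q+q≡2q+k k q) ⟩
    f (2 *ℕ q +ℕ k)                        ≡⟨ antiperiodic-shift anti q k ⟩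
    signℚ (altSign q) * f k                ≡⟨ cong (λ t → signℚ (altSign t) * f k) q≡ ⟩
    signℚ (altSign (suc (2 *ℕ m))) * f k   ≡⟨ cong (λ t → signℚ t * f k) (altSign-odd m) ⟩
    signℚ minus * f k                      ≡⟨ minus-* (f k) ⟩
    - f k                                  ∎)
    where open ≡-Reasoning

  even-vanish : ∀ {f q s m} → AntiPeriodic f → Twisted q s f → q ≡ 2 *ℕ m → altSign m ≢ s →
    ∀ k → f k ≡ 0ℚ
  even-vanish {f} {q} {s} {m} anti tw q≡ m≢s k = sign-separates (altSign m) s (f k) m≢s (begin
    signℚ (altSign m) * f k   ≡⟨ sym (antiperiodic-shift anti m k) ⟩
    f (2 *ℕ m +ℕ k)           ≡⟨ cong f (trans (ℕ.+-comm (2 *ℕ m) k) (cong (k +ℕ_) (sym q≡))) ⟩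
    f (k +ℕ q)                ≡⟨ tw k ⟩
    signℚ s * f k             ∎)
    where open ≡-Reasoning

  antiperiodic-twisted : ∀ {f} → AntiPeriodic f → ∀ m → Twisted (2 *ℕ m) (altSign m) f
  antiperiodic-twisted {f} anti m k = trans (cong f (ℕ.+-comm k (2 *ℕ m))) (antiperiodic-shift anti m k)

  pulse : ℚ → ℚ → ℕ → ℚ
  pulse a b zero          = a
  pulse a b (suc zero)    = b
  pulse a b (suc (suc k)) = - pulse a b k

  pulse-antiperiodic : ∀ a b → AntiPeriodic (pulse a b)
  pulse-antiperiodic a b k = refl

  pulse-vanishes : ∀ k → pulse 1ℚ 0ℚ k ≡ 0ℚ ⊎ pulse 0ℚ 1ℚ k ≡ 0ℚ
  pulse-vanishes zero          = inj₂ refl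
  pulse-vanishes (suc zero)    = inj₁ refl
  pulse-vanishes (suc (suc k)) = Data.Sum.map (cong -_) (cong -_) (pulse-vanishes k)

  periodic-mod : ∀ q .{{_ : NonZero q}} (g : ℕ → ℚ) → (∀ k → g (k +ℕ q) ≡ g k) → ∀ k → g (k % q) ≡ g k
  periodic-mod q g per k = trans (sym (periods (k % q) (k / q))) (cong g (sym (m≡m%n+[m/n]*n k q)))
    where
    periods : ∀ r t → g (r +ℕ t *ℕ q) ≡ g r
    periods r zero    = cong g (ℕ.+-identityʳ r)
    periods r (suc t) = begin
      g (r +ℕ (q +ℕ t *ℕ q))   ≡⟨ cong g (r+[q+x]≡r+x+q r q (t *ℕ q)) ⟩
      g (r +ℕ t *ℕ q +ℕ q)     ≡⟨ per (r +ℕ t *ℕ q) ⟩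
      g (r +ℕ t *ℕ q)          ≡⟨ periods r t ⟩
      g r                      ∎
      where open ≡-Reasoning

module CycleRank where

  open import Defs
  open Signs
  open RowDependence
  open CycleAdjacency using (Succ; isSucc-complete; column-sum)
  open SignedSequences
  open import Data.Nat using (ℕ; zero; suc; _≤_; _<_; s≤s; z≤n; _%_)
    renaming (_+_ to _+ℕ_; _*_ to _*ℕ_)
  import Data.Nat.Properties as ℕ
  open import Data.Nat.DivMod using (m%n<n; m<n⇒m%n≡m; %-distribˡ-+; [m+n]%n≡m%n; n%n≡0)
  open import Data.Fin using (Fin; toℕ; fromℕ<; inject≤)
  import Data.Fin as F
  open import Data.Fin.Properties using (toℕ-injective; toℕ<n; toℕ-fromℕ<; toℕ-inject≤; inject≤-injective)
  open import Data.Rational using (ℚ; 0ℚ; 1ℚ; _+_; _*_; -_)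
  open import Data.Rational.Properties using (*-comm; *-zeroˡ; +-inverseʳ; +-0-group)
  open import Algebra.Properties.Group +-0-group using (inverseʳ-unique)
  open import Data.Rational.Solver using (module +-*-Solver)
  open +-*-Solver using (solve; _:=_; _:*_; _:+_)
  open import Data.Bool using (true)
  open import Data.Product using (_,_)
  open import Data.Sum using (inj₁; inj₂)
  open import Function.Definitions using (Injective)
  open import Relation.Nullary using (¬_)
  open import Relation.Binary.PropositionalEquality

  signProduct : (ℕ → Sign) → ℕ → Sign
  signProduct s zero    = plus
  signProduct s (suc k) = signProduct s k ·ₛ s k

  signProduct-head : ∀ s k → signProduct s (suc k) ≡ s 0 ·ₛ signProduct (λ i → s (suc i)) k
  signProduct-head s zero    = ·ₛ-comm plus (s 0)
  signProduct-head s (suc k) =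
    trans (cong (_·ₛ s (suc k)) (signProduct-head s k)) (·ₛ-assoc (s 0) _ _)

  Πₛ≡signProduct : ∀ k (f : Fin k → Sign) (s : ℕ → Sign) → (∀ i → s (toℕ i) ≡ f i) → Πₛ f ≡ signProduct s k
  Πₛ≡signProduct zero    f s s≗f = refl
  Πₛ≡signProduct (suc k) f s s≗f =
    trans (cong₂ _·ₛ_ (sym (s≗f F.zero)) tail-products) (sym (signProduct-head s k))
    where
    tail-products = Πₛ≡signProduct k (λ i → f (F.suc i)) (λ i → s (suc i)) (λ i → s≗f (F.suc i))

  module SignedCycle (n : ℕ) (σ : Signature (suc (suc (suc n)))) where

    q : ℕ
    q = suc (suc (suc n))

    3≤q : 3 ≤ q
    3≤q = s≤s (s≤s (s≤s z≤n))

    A : Fin q → Fin q → ℚ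
    A = adjMatrix q σ

    vertex : ℕ → Fin q
    vertex k = fromℕ< (m%n<n k q)

    toℕ-vertex : ∀ k → toℕ (vertex k) ≡ k % q
    toℕ-vertex k = toℕ-fromℕ< (m%n<n k q)

    vertex-toℕ : ∀ i → vertex (toℕ i) ≡ i
    vertex-toℕ i = toℕ-injective (trans (toℕ-vertex (toℕ i)) (m<n⇒m%n≡m (toℕ<n i)))

    vertex-+q : ∀ k → vertex (k +ℕ q) ≡ vertex k
    vertex-+q k = toℕ-injective (trans (toℕ-vertex (k +ℕ q)) (trans ([m+n]%n≡m%n k q) (sym (toℕ-vertex k))))

    vertex-succ : ∀ k → isSucc q (vertex k) (vertex (suc k)) ≡ true
    vertex-succ k = isSucc-complete q (vertex k) (vertex (suc k))
      (subst₂ (Succ q) (sym (toℕ-vertex k)) (sym (toℕ-vertex (suc k))) step)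
      where
      suc-mod : suc k % q ≡ suc (k % q) % q
      suc-mod = %-distribˡ-+ 1 k q
      step : Succ q (k % q) (suc k % q)
      step with ℕ.m≤n⇒m<n∨m≡n (m%n<n k q)
      ... | inj₁ k%q+1<q = inj₁ (sym (trans suc-mod (m<n⇒m%n≡m k%q+1<q)))
      ... | inj₂ k%q+1≡q = inj₂ (k%q+1≡q , trans suc-mod (trans (cong (_% q) k%q+1≡q) (n%n≡0 q)))

    walk : ℕ → Sign
    walk = signProduct (λ k → σ (vertex k))

    walkℚ : ℕ → ℚ
    walkℚ k = signℚ (walk k)

    walk-cycle : walk q ≡ cycleSign σ
    walk-cycle = sym (Πₛ≡signProduct q σ (λ k → σ (vertex k)) (λ i → cong σ (vertex-toℕ i)))

    walk-+q : ∀ k → walk (k +ℕ q) ≡ walk k ·ₛ cycleSign σ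
    walk-+q zero    = walk-cycle
    walk-+q (suc k) = begin
      walk (k +ℕ q) ·ₛ σ (vertex (k +ℕ q))       ≡⟨ cong₂ _·ₛ_ (walk-+q k) (cong σ (vertex-+q k)) ⟩
      (walk k ·ₛ S) ·ₛ σ (vertex k)              ≡⟨ ·ₛ-assoc (walk k) S _ ⟩
      walk k ·ₛ (S ·ₛ σ (vertex k))              ≡⟨ cong (walk k ·ₛ_) (·ₛ-comm S _) ⟩
      walk k ·ₛ (σ (vertex k) ·ₛ S)              ≡⟨ sym (·ₛ-assoc (walk k) _ S) ⟩
      (walk k ·ₛ σ (vertex k)) ·ₛ S              ∎
      where
      open ≡-Reasoning
      S = cycleSign σ

    walkℚ-+q : ∀ k → walkℚ (k +ℕ q) ≡ walkℚ k * signℚ (cycleSign σ)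
    walkℚ-+q k = trans (cong signℚ (walk-+q k)) (signℚ-· (walk k) (cycleSign σ))

    walkℚ-suc : ∀ k → walkℚ (suc k) ≡ walkℚ k * signℚ (σ (vertex k))
    walkℚ-suc k = signℚ-· (walk k) (σ (vertex k))

    -- Switching at every vertex by the walk sign turns the kernel equations into
    -- the recurrence "next but one = − current".
    switch : (Fin q → ℚ) → ℕ → ℚ
    switch c k = c (vertex k) * walkℚ k

    column-switch : ∀ c k →
      Σℚ (λ i → c i * A i (vertex (suc k))) * walkℚ (suc k) ≡ switch c k + switch c (suc (suc k))
    column-switch c k = begin
      Σℚ (λ i → c i * A i (vertex (suc k))) * walkℚ (suc k)
        ≡⟨ cong₂ _*_ (column-sum q 3≤q σ c (vertex k) (vertex (suc k)) (vertex (suc (suc k)))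
                                  (vertex-succ k) (vertex-succ (suc k)))
                     (walkℚ-suc k) ⟩
      (c₀ * e₀ + c₂ * e₁) * (w * e₀)
        ≡⟨ solve 5 (λ c₀ c₂ e₀ e₁ w → (c₀ :* e₀ :+ c₂ :* e₁) :* (w :* e₀)
                                    := c₀ :* w :* e₀ :* e₀ :+ c₂ :* (w :* e₀ :* e₁))
                 refl c₀ c₂ e₀ e₁ w ⟩
      c₀ * w * e₀ * e₀ + c₂ * (w * e₀ * e₁)
        ≡⟨ cong (_+ c₂ * (w * e₀ * e₁)) (*-sign-sign (c₀ * w) (σ (vertex k))) ⟩
      c₀ * w + c₂ * (w * e₀ * e₁)
        ≡⟨ cong (λ t → c₀ * w + c₂ * t) (sym (trans (walkℚ-suc (suc k)) (cong (_* e₁) (walkℚ-suc k)))) ⟩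
      switch c k + switch c (suc (suc k))
        ∎
      where
      open ≡-Reasoning
      c₀ = c (vertex k)
      c₂ = c (vertex (suc (suc k)))
      e₀ = signℚ (σ (vertex k))
      e₁ = signℚ (σ (vertex (suc k)))
      w  = walkℚ k

    kernel⇒antiperiodic : ∀ c → LeftKernel A c → AntiPeriodic (switch c)
    kernel⇒antiperiodic c K k = inverseʳ-unique (switch c k) (switch c (suc (suc k))) (begin
      switch c k + switch c (suc (suc k))                        ≡⟨ sym (column-switch c k) ⟩
      Σℚ (λ i → c i * A i (vertex (suc k))) * walkℚ (suc k)      ≡⟨ cong (_* walkℚ (suc k)) (K (vertex (suc k))) ⟩
      0ℚ * walkℚ (suc k)                                         ≡⟨ *-zeroˡ (walkℚ (suc k)) ⟩
      0ℚ                                                         ∎)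
      where open ≡-Reasoning

    antiperiodic⇒kernel : ∀ c → AntiPeriodic (switch c) → LeftKernel A c
    antiperiodic⇒kernel c anti j = subst (λ j → Σℚ (λ i → c i * A i j) ≡ 0ℚ) column-j column-zero
      where
      open ≡-Reasoning
      -- column j is the column of the vertex following k = j − 1 (mod q)
      k = toℕ j +ℕ suc (suc n)
      column-j : vertex (suc k) ≡ j
      column-j = trans (cong vertex (sym (ℕ.+-suc (toℕ j) (suc (suc n)))))
                       (trans (vertex-+q (toℕ j)) (vertex-toℕ j))
      column-zero : Σℚ (λ i → c i * A i (vertex (suc k))) ≡ 0ℚ
      column-zero = sign-*-zero (walk (suc k)) _ (begin
        walkℚ (suc k) * Σℚ (λ i → c i * A i (vertex (suc k)))      ≡⟨ *-comm (walkℚ (suc k)) _ ⟩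
        Σℚ (λ i → c i * A i (vertex (suc k))) * walkℚ (suc k)      ≡⟨ column-switch c k ⟩
        switch c k + switch c (suc (suc k))                        ≡⟨ cong (switch c k +_) (anti k) ⟩
        switch c k + - switch c k                                  ≡⟨ +-inverseʳ (switch c k) ⟩
        0ℚ                                                         ∎)

    switch-twisted : ∀ c → Twisted q (cycleSign σ) (switch c)
    switch-twisted c k = begin
      c (vertex (k +ℕ q)) * walkℚ (k +ℕ q)              ≡⟨ cong₂ _*_ (cong c (vertex-+q k)) (walkℚ-+q k) ⟩
      c (vertex k) * (walkℚ k * signℚ S)                ≡⟨ solve 3 (λ x w s → x :* (w :* s) := s :* (x :* w)) refl
                                                             (c (vertex k)) (walkℚ k) (signℚ S) ⟩
      signℚ S * switch c k                              ∎
      where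
      open ≡-Reasoning
      S = cycleSign σ

    switch-vanishes : ∀ c → (∀ k → switch c k ≡ 0ℚ) → ∀ i → c i ≡ 0ℚ
    switch-vanishes c vanishes i = begin
      c i                                              ≡⟨ cong c (sym (vertex-toℕ i)) ⟩
      c (vertex (toℕ i))                               ≡⟨ sym (*-sign-sign _ (walk (toℕ i))) ⟩
      switch c (toℕ i) * walkℚ (toℕ i)                 ≡⟨ cong (_* walkℚ (toℕ i)) (vanishes (toℕ i)) ⟩
      0ℚ * walkℚ (toℕ i)                               ≡⟨ *-zeroˡ (walkℚ (toℕ i)) ⟩
      0ℚ                                               ∎
      where open ≡-Reasoning

    unswitch : (ℕ → ℚ) → Fin q → ℚ
    unswitch f i = f (toℕ i) * walkℚ (toℕ i)

    switch-unswitch : ∀ f → Twisted q (cycleSign σ) f → ∀ k → switch (unswitch f) k ≡ f k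
    switch-unswitch f tw k = begin
      g (toℕ (vertex k)) * walkℚ k      ≡⟨ cong (λ t → g t * walkℚ k) (toℕ-vertex k) ⟩
      g (k % q) * walkℚ k               ≡⟨ cong (_* walkℚ k) (periodic-mod q g g-periodic k) ⟩
      f k * walkℚ k * walkℚ k           ≡⟨ *-sign-sign (f k) (walk k) ⟩
      f k                               ∎
      where
      open ≡-Reasoning
      S = cycleSign σ
      g : ℕ → ℚ
      g k = f k * walkℚ k
      g-periodic : ∀ k → g (k +ℕ q) ≡ g k
      g-periodic k = begin
        f (k +ℕ q) * walkℚ (k +ℕ q)                ≡⟨ cong₂ _*_ (tw k) (walkℚ-+q k) ⟩
        signℚ S * f k * (walkℚ k * signℚ S)        ≡⟨ solve 3 (λ s x w → s :* x :* (w :* s) := x :* w :* s :* s) refl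
                                                        (signℚ S) (f k) (walkℚ k) ⟩
        f k * walkℚ k * signℚ S * signℚ S          ≡⟨ *-sign-sign (g k) S ⟩
        g k                                        ∎

    unswitch-kernel : ∀ f → AntiPeriodic f → Twisted q (cycleSign σ) f → LeftKernel A (unswitch f)
    unswitch-kernel f anti tw = antiperiodic⇒kernel (unswitch f) (λ k → begin
      switch (unswitch f) (suc (suc k))    ≡⟨ switch-unswitch f tw (suc (suc k)) ⟩
      f (suc (suc k))                      ≡⟨ anti k ⟩
      - f k                                ≡⟨ cong -_ (sym (switch-unswitch f tw k)) ⟩
      - switch (unswitch f) k              ∎)
      where open ≡-Reasoning

    rank-odd : ∀ {m r} → q ≡ suc (2 *ℕ m) → IsRank A r → r ≡ q
    rank-odd {m} q≡ R = full-rank A R (λ c K →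
      switch-vanishes c (odd-vanish {s = cycleSign σ} {m = m} (kernel⇒antiperiodic c K) (switch-twisted c) q≡))

    rank-even : ∀ {m r} → q ≡ 2 *ℕ m → altSign m ≢ cycleSign σ → IsRank A r → r ≡ q
    rank-even {m} q≡ m≢S R = full-rank A R (λ c K →
      switch-vanishes c (even-vanish {m = m} (kernel⇒antiperiodic c K) (switch-twisted c) q≡ m≢S))

    rank-≥ : ∀ {r} → IsRank A r → suc n ≤ r
    rank-≥ R = rank-lower A R first first-inj (independent-rows A first first-inj only-zero)
      where
      n+1≤q : suc n ≤ q
      n+1≤q = ℕ.m≤n⇒m≤1+n (ℕ.n≤1+n (suc n))
      first : Fin (suc n) → Fin q
      first i = inject≤ i n+1≤q
      first-inj : Injective _≡_ _≡_ first
      first-inj {x} {y} = inject≤-injective n+1≤q n+1≤q x y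
      not-first : ∀ k → suc n ≤ k → k < q → Outside first (vertex k)
      not-first k n+1≤k k<q i first-i≡vertex-k = ℕ.<⇒≱ below (ℕ.≤-trans n+1≤k (ℕ.≤-reflexive (sym toℕ-first-i)))
        where
        below : toℕ (first i) < suc n
        below = subst (_< suc n) (sym (toℕ-inject≤ i n+1≤q)) (toℕ<n i)
        toℕ-first-i : toℕ (first i) ≡ k
        toℕ-first-i = trans (cong toℕ first-i≡vertex-k) (trans (toℕ-vertex k) (m<n⇒m%n≡m k<q))
      switch-zero : ∀ z k → z (vertex k) ≡ 0ℚ → switch z k ≡ 0ℚ
      switch-zero z k zk = trans (cong (_* walkℚ k) zk) (*-zeroˡ (walkℚ k))
      only-zero : ∀ z → LeftKernel A z → (∀ l → Outside first l → z l ≡ 0ℚ) → ∀ l → z l ≡ 0ℚ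
      only-zero z K outside-zero = switch-vanishes z (antiperiodic-vanish (kernel⇒antiperiodic z K) (suc n) z₁ z₂)
        where
        z₁ : switch z (suc n) ≡ 0ℚ
        z₁ = switch-zero z (suc n)
               (outside-zero _ (not-first (suc n) ℕ.≤-refl (ℕ.m<n⇒m<1+n (ℕ.n<1+n (suc n)))))
        z₂ : switch z (suc (suc n)) ≡ 0ℚ
        z₂ = switch-zero z (suc (suc n))
               (outside-zero _ (not-first (suc (suc n)) (ℕ.n≤1+n (suc n)) (ℕ.n<1+n (suc (suc n)))))

    -- If σ(C_{2m}) = (−1)^m, the pulses give two kernel vectors, one vanishing at even and one at
    -- odd vertices; the one vanishing at the row left out makes any q − 1 rows dependent.
    rank-< : ∀ {m r} → q ≡ 2 *ℕ m → altSign m ≡ cycleSign σ → IsRank A r → r < suc (suc n)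
    rank-< {m} q≡ m≡S R = rank-upper A R dependent
      where
      pulse-twisted : ∀ a b → Twisted q (cycleSign σ) (pulse a b)
      pulse-twisted a b = subst₂ (λ q s → Twisted q s (pulse a b)) (sym q≡) m≡S
                                 (antiperiodic-twisted (pulse-antiperiodic a b) m)
      pulse-dependent : ∀ a b w → pulse a b w ≢ 0ℚ → (g : Fin (suc (suc n)) → Fin q) → Injective _≡_ _≡_ g →
        (l : Fin q) → Outside g l → pulse a b (toℕ l) ≡ 0ℚ → ¬ LinIndep (λ i → A (g i))
      pulse-dependent a b w fw≢0 g g-inj l l-out fl≡0 =
        dependent-rows A g g-inj z (unswitch-kernel f (pulse-antiperiodic a b) (pulse-twisted a b))
                       z-outside (vertex w) zw≢0
        where
        f = pulse a b
        z = unswitch f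
        z-outside : ∀ l′ → Outside g l′ → z l′ ≡ 0ℚ
        z-outside l′ l′-out = trans (cong z (missing-unique g g-inj l′ l l′-out l-out))
                                    (trans (cong (_* walkℚ (toℕ l)) fl≡0) (*-zeroˡ (walkℚ (toℕ l))))
        zw≢0 : z (vertex w) ≢ 0ℚ
        zw≢0 zw≡0 = fw≢0 (trans (sym (switch-unswitch f (pulse-twisted a b) w))
                                (trans (cong (_* walkℚ w) zw≡0) (*-zeroˡ (walkℚ w))))
      dependent : (g : Fin (suc (suc n)) → Fin q) → Injective _≡_ _≡_ g → ¬ LinIndep (λ i → A (g i))
      dependent g g-inj with missing-point g g-inj
      ... | l , l-out with pulse-vanishes (toℕ l)
      ...   | inj₁ vanishes = pulse-dependent 1ℚ 0ℚ 0 (λ ()) g g-inj l l-out vanishes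
      ...   | inj₂ vanishes = pulse-dependent 0ℚ 1ℚ 1 (λ ()) g g-inj l l-out vanishes

module Characterisation where

  open import Defs
  open SignedSequences using (altSign)
  open CycleRank using (module SignedCycle)
  open import Data.Nat using (ℕ; zero; suc; _+_; _*_; _∸_; _≤_; _<_; _%_; s≤s)
  import Data.Nat.Properties as ℕ
  open import Data.Nat.DivMod using (%-distribˡ-+)
  open import Data.Product using (_×_; _,_)
  open import Data.Sum using (_⊎_; inj₁; inj₂)
  open import Data.Empty using (⊥-elim)
  open import Function.Bundles using (_⇔_; mk⇔)
  import Function.Properties.Equivalence as ⇔
  open import Relation.Nullary using (¬_; Dec; yes; no)
  open import Relation.Binary.PropositionalEquality

  _≟ₛ_ : (s t : Sign) → Dec (s ≡ t)
  plus  ≟ₛ plus  = yes refl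
  plus  ≟ₛ minus = no λ ()
  minus ≟ₛ plus  = no λ ()
  minus ≟ₛ minus = yes refl

  data Parity (q : ℕ) : Set where
    even : ∀ m → q ≡ 2 * m → Parity q
    odd  : ∀ m → q ≡ suc (2 * m) → Parity q

  parity : ∀ q → Parity q
  parity zero = even 0 refl
  parity (suc q) with parity q
  ... | even m q≡ = odd m (cong suc q≡)
  ... | odd  m q≡ = even (suc m) (trans (cong suc q≡) (sym (ℕ.*-suc 2 m)))

  Balanced : ℕ → Sign → Set
  Balanced q s = (q % 4 ≡ 0 × s ≡ plus) ⊎ (q % 4 ≡ 2 × s ≡ minus)

  balanced-unique : ∀ {q s t} → Balanced q s → Balanced q t → s ≡ t
  balanced-unique (inj₁ (_ , s≡+)) (inj₁ (_ , t≡+)) = trans s≡+ (sym t≡+)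
  balanced-unique (inj₂ (_ , s≡-)) (inj₂ (_ , t≡-)) = trans s≡- (sym t≡-)
  balanced-unique (inj₁ (r , _))   (inj₂ (r′ , _)) with () ← trans (sym r) r′
  balanced-unique (inj₂ (r , _))   (inj₁ (r′ , _)) with () ← trans (sym r) r′

  shift-mod4 : ∀ d m {x} → 2 * m % 4 ≡ x → (d + 2 * m) % 4 ≡ (d % 4 + x) % 4
  shift-mod4 d m r = trans (%-distribˡ-+ d (2 * m) 4) (cong (λ t → (d % 4 + t) % 4) r)

  double-balanced : ∀ m → Balanced (2 * m) (altSign m)
  double-balanced zero    = inj₁ (refl , refl)
  double-balanced (suc m) =
    subst (λ t → Balanced t (altSign (suc m))) (sym (ℕ.*-suc 2 m)) (add-two (double-balanced m))
    where
    add-two : Balanced (2 * m) (altSign m) → Balanced (2 + 2 * m) (minus ·ₛ altSign m)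
    add-two (inj₁ (r , s)) = inj₂ (shift-mod4 2 m r , cong (minus ·ₛ_) s)
    add-two (inj₂ (r , s)) = inj₁ (shift-mod4 2 m r , cong (minus ·ₛ_) s)

  balanced-even : ∀ {q m} s → q ≡ 2 * m → Balanced q s ⇔ (altSign m ≡ s)
  balanced-even {m = m} s refl =
    mk⇔ (balanced-unique {2 * m} (double-balanced m)) (λ m≡s → subst (Balanced (2 * m)) m≡s (double-balanced m))

  balanced-odd : ∀ {q m} s → q ≡ suc (2 * m) → ¬ Balanced q s
  balanced-odd {m = m} s refl b with double-balanced m | b
  ... | inj₁ (r , _) | inj₁ (r′ , _) with () ← trans (sym (shift-mod4 1 m r)) r′
  ... | inj₁ (r , _) | inj₂ (r′ , _) with () ← trans (sym (shift-mod4 1 m r)) r′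
  ... | inj₂ (r , _) | inj₁ (r′ , _) with () ← trans (sym (shift-mod4 1 m r)) r′
  ... | inj₂ (r , _) | inj₂ (r′ , _) with () ← trans (sym (shift-mod4 1 m r)) r′

  floor-half : ∀ {a q} → a + a ≤ q → q ≤ suc (a + a) → 2 * a ≡ q ⊎ suc (2 * a) ≡ q
  floor-half {a} {q} 2a≤q q≤2a+1 =
    subst (λ t → t ≡ q ⊎ suc t ≡ q) (cong (a +_) (sym (ℕ.+-identityʳ a))) (cases (ℕ.m≤n⇒m<n∨m≡n q≤2a+1))
    where
    cases : q < suc (a + a) ⊎ q ≡ suc (a + a) → a + a ≡ q ⊎ suc (a + a) ≡ q
    cases (inj₁ (s≤s q≤2a)) = inj₁ (ℕ.≤-antisym 2a≤q q≤2a)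
    cases (inj₂ q≡2a+1)     = inj₂ (sym q≡2a+1)

  twice-minus-cyclomatic : ∀ n → let q = suc (suc (suc n)) in 2 * q ∸ 2 * cyclomaticCycle q ≡ suc n + q
  twice-minus-cyclomatic n = cong (λ t → suc (n + t)) (ℕ.+-identityʳ (suc (suc (suc n))))

  rank-drop : ∀ n σ {m r} → let open SignedCycle n σ in
    q ≡ 2 * m → IsRank A r → (r ≡ suc n) ⇔ (altSign m ≡ cycleSign σ)
  rank-drop n σ {m} {r} q≡ R = mk⇔ to from
    where
    open SignedCycle n σ
    from : altSign m ≡ cycleSign σ → r ≡ suc n
    from balanced = ℕ.≤-antisym (ℕ.≤-pred (rank-< {m} q≡ balanced R)) (rank-≥ R)
    to : r ≡ suc n → altSign m ≡ cycleSign σ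
    to r≡n+1 with altSign m ≟ₛ cycleSign σ
    ... | yes balanced = balanced
    ... | no unbalanced =
      ⊥-elim (ℕ.<-irrefl (trans (sym r≡n+1) (rank-even {m} q≡ unbalanced R)) (ℕ.m<n⇒m<1+n (ℕ.n<1+n (suc n))))

  even-case : ∀ n σ {m r a} → let open SignedCycle n σ in
    q ≡ 2 * m → IsRank A r → 2 * a ≡ q → (r + 2 * a ≡ suc n + q) ⇔ Balanced q (cycleSign σ)
  even-case n σ {m} {r} {a} q≡ R 2a≡q =
    ⇔.trans (mk⇔ cancel uncancel) (⇔.trans (rank-drop n σ {m} q≡ R) (⇔.sym (balanced-even {m = m} (cycleSign σ) q≡)))
    where
    open SignedCycle n σ using (q)
    cancel : r + 2 * a ≡ suc n + q → r ≡ suc n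
    cancel e = ℕ.+-cancelʳ-≡ q r (suc n) (trans (cong (r +_) (sym 2a≡q)) e)
    uncancel : r ≡ suc n → r + 2 * a ≡ suc n + q
    uncancel e = cong₂ _+_ e 2a≡q

  -- Odd cycles have full rank and 2α = q − 1, so r + 2α = 2q − 1 ≠ 2q − 2.
  odd-case : ∀ n σ {m r a} → let open SignedCycle n σ in
    q ≡ suc (2 * m) → IsRank A r → suc (2 * a) ≡ q → ¬ (r + 2 * a ≡ suc n + q)
  odd-case n σ {m} {r} {a} q≡ R 2a+1≡q e = ℕ.<-irrefl (sym q≡n+2) (ℕ.n<1+n (suc (suc n)))
    where
    open SignedCycle n σ
    2a≡n+1 : 2 * a ≡ suc n
    2a≡n+1 = ℕ.+-cancelˡ-≡ q (2 * a) (suc n)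
               (trans (cong (_+ 2 * a) (sym (rank-odd {m} q≡ R))) (trans e (ℕ.+-comm (suc n) q)))
    q≡n+2 : q ≡ suc (suc n)
    q≡n+2 = trans (sym 2a+1≡q) (cong suc 2a≡n+1)

open import Defs
open import Data.Nat using (ℕ; zero; suc; _+_; _*_; _∸_; _≤_; _%_; s≤s)
open import Data.Product using (_×_; proj₁; proj₂)
open import Data.Sum using (_⊎_; inj₁; inj₂)
open import Data.Empty using (⊥-elim)
open import Function.Bundles using (_⇔_; mk⇔)
open import Relation.Binary.PropositionalEquality using (_≡_; subst; sym; trans)
import Data.Nat.Properties as ℕ
open IndependenceNumber using (independence-number-bounds)
open CycleRank using (module SignedCycle)
open Characterisation

lemma4p1 : (q : ℕ) → 3 ≤ q → (σ : Signature q) → (r a : ℕ)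
    → IsRank (adjMatrix q σ) r
    → IsIndependenceNumber (CycleAdj q) a
    → ((r + 2 * a ≡ 2 * q ∸ 2 * cyclomaticCycle q)
    ⇔ ((q % 4 ≡ 0 × cycleSign σ ≡ plus) ⊎ (q % 4 ≡ 2 × cycleSign σ ≡ minus)))
lemma4p1 (suc zero)          (s≤s ())
lemma4p1 (suc (suc zero))    (s≤s (s≤s ()))
lemma4p1 (suc (suc (suc n))) _ σ r a R I =
  subst (λ t → (r + 2 * a ≡ t) ⇔ Balanced q (cycleSign σ)) (sym (twice-minus-cyclomatic n))
        (by-parity (parity q) (floor-half {a} (proj₁ α-bounds) (proj₂ α-bounds)))
  where
  open SignedCycle n σ using (q)
  α-bounds : a + a ≤ q × q ≤ suc (a + a)
  α-bounds = independence-number-bounds I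
  by-parity : Parity q → 2 * a ≡ q ⊎ suc (2 * a) ≡ q → (r + 2 * a ≡ suc n + q) ⇔ Balanced q (cycleSign σ)
  by-parity (even m q≡) (inj₁ 2a≡q)   = even-case n σ {m} {a = a} q≡ R 2a≡q
  by-parity (even m q≡) (inj₂ 2a+1≡q) = ⊥-elim (ℕ.even≢odd m a (trans (sym q≡) (sym 2a+1≡q)))
  by-parity (odd m q≡)  (inj₁ 2a≡q)   = ⊥-elim (ℕ.even≢odd a m (trans 2a≡q q≡))
  by-parity (odd m q≡)  (inj₂ 2a+1≡q) =
    mk⇔ (λ e → ⊥-elim (odd-case n σ {m} {a = a} q≡ R 2a+1≡q e))
        (λ b → ⊥-elim (balanced-odd {m = m} (cycleSign σ) q≡ b))
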